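{- Let $k$ be a non-negative integer, $l\in\{0,1,\dots,k\}$, and consider the equation \[ x^2-(2^{2k+2}+1)y^2=-2^{2l+1} \] in positive integers $x,y$. (i) If $k\equiv 0\pmod 2$, then the equation has no solutions. (ii) If $k\equiv 1\pmod 2$, then the equation has a solution when $l>\frac{k}{2}$, and has no solutions when $l\leq \frac{k}{2}$. -}

module Defs where

open import Data.Nat using (ℕ; _+_; _*_; _^_; _<_)
open import Data.Product using (∃-syntax; _×_)
open import Relation.Binary.PropositionalEquality using (_≡_)

-- The equation x^2 - (2^(2k+2)+1) y^2 = -2^(2l+1) in positive integers x, y,
-- rearranged (equivalently, without subtraction) as
-- x^2 + 2^(2l+1) = (2^(2k+2)+1) y^2 over ℕ.
HasSolution : ℕ → ℕ → Set
HasSolution k l =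
  ∃[ x ] ∃[ y ] (0 < x × 0 < y ×
    x * x + 2 ^ (2 * l + 1) ≡ (2 ^ (2 * k + 2) + 1) * (y * y))

{-# OPTIONS --safe #-}
module Submission where

-- Write n = 2^(k+1) and M = 2^(2l+1), so that the equation reads x² + M = (n² + 1) y².
--
-- For even k, n² + 1 = 4^(k+1) + 1 is divisible by 5, while x² + M ≡ x² ± 2 (mod 5) is not.
--
-- For odd k and 2l > k write 2l = k + 1 + 2j; then x = (n − 1) 2^j, y = 2^j is a solution,
-- since (n − 1)² + 2n = n² + 1.
--
-- For 2l ≤ k we have M < 2n, and M ≡ 2 (mod 3) is not a square. Putting a = x + n y, the
-- equation says that the form a² − 2n·a·b − b² takes the value −M at (a, y). The reflection
-- (a, b) ↦ (b, a − 2n b) turns a representation of ±M into one of ∓M with a smaller second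
-- coordinate as long as M < 2n, and at b = 0 it would force a² = ±M.

open import Data.List using (_∷_; [])
open import Data.Nat using (ℕ; zero; suc; _+_; _*_; _^_; _/_; _%_; _≤_; _<_; _>_; _≤?_; z≤n; s≤s; z<s; NonZero)
open import Data.Nat.DivMod using (m≡m%n+[m/n]*n; m%n%n≡m%n; m%n<n; %-distribˡ-+; %-distribˡ-*; m<n*o⇒m/o<n)
open import Data.Nat.Divisibility using (_∣_; divides-refl; m%n≡0⇒n∣m)
open import Data.Nat.Induction using (<-rec)
open import Data.Nat.Properties
open import Data.Nat.Tactic.RingSolver using (solve; solve-∀)
open import Data.Product using (_×_; _,_; proj₁; proj₂; ∃-syntax)
open import Data.Sum using (_⊎_; inj₁; inj₂)
open import Relation.Binary.PropositionalEquality using (_≡_; _≢_; refl; sym; trans; cong; cong₂; subst)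
open import Relation.Nullary using (¬_; yes; no; contradiction)

open import Defs

open ≤-Reasoning

m%d≡1⇒m^n%d≡1 : ∀ m n d .{{_ : NonZero d}} → m % d ≡ 1 → m ^ n % d ≡ 1
m%d≡1⇒m^n%d≡1 m n d m%d≡1 = go n
  where
    1%d≡1 : 1 % d ≡ 1
    1%d≡1 = trans (cong (_% d) (sym m%d≡1)) (trans (m%n%n≡m%n m d) m%d≡1)

    go : ∀ n → m ^ n % d ≡ 1
    go zero    = 1%d≡1
    go (suc n) = begin-equality
      m * m ^ n % d              ≡⟨ %-distribˡ-* m (m ^ n) d ⟩
      (m % d) * (m ^ n % d) % d  ≡⟨ cong₂ (λ r s → r * s % d) m%d≡1 (go n) ⟩
      1 * 1 % d                  ≡⟨ 1%d≡1 ⟩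
      1                          ∎

m*m%3≢2 : ∀ m → m * m % 3 ≢ 2
m*m%3≢2 m eq = residue (m % 3) (m%n<n m 3) (trans (sym (%-distribˡ-* m m 3)) eq)
  where
    residue : ∀ r → r < 3 → r * r % 3 ≢ 2
    residue 0 _ ()
    residue 1 _ ()
    residue 2 _ ()
    residue (suc (suc (suc _))) (s≤s (s≤s (s≤s ())))

4^n%5≡1⊎4 : ∀ n → 4 ^ n % 5 ≡ 1 ⊎ 4 ^ n % 5 ≡ 4
4^n%5≡1⊎4 zero    = inj₁ refl
4^n%5≡1⊎4 (suc n) with 4 ^ n % 5 in eq | 4^n%5≡1⊎4 n
... | _ | inj₁ refl = inj₂ (trans (%-distribˡ-* 4 (4 ^ n) 5) (cong (λ r → 4 * r % 5) eq))
... | _ | inj₂ refl = inj₁ (trans (%-distribˡ-* 4 (4 ^ n) 5) (cong (λ r → 4 * r % 5) eq))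

[m*m+2*4^n]%5≢0 : ∀ m n → (m * m + 2 * 4 ^ n) % 5 ≢ 0
[m*m+2*4^n]%5≢0 m n eq = residue (m % 5) (m%n<n m 5) (4^n%5≡1⊎4 n) (begin-equality
  (m % 5 * (m % 5) % 5 + 2 * (4 ^ n % 5) % 5) % 5  ≡⟨ cong₂ (λ a b → (a + b) % 5) (%-distribˡ-* m m 5) (%-distribˡ-* 2 (4 ^ n) 5) ⟨
  (m * m % 5 + 2 * 4 ^ n % 5) % 5                  ≡⟨ %-distribˡ-+ (m * m) (2 * 4 ^ n) 5 ⟨
  (m * m + 2 * 4 ^ n) % 5                          ≡⟨ eq ⟩
  0                                                ∎)
  where
    residue : ∀ r → r < 5 → ∀ {t} → t ≡ 1 ⊎ t ≡ 4 → (r * r % 5 + 2 * t % 5) % 5 ≢ 0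
    residue 0 _ (inj₁ refl) ()
    residue 0 _ (inj₂ refl) ()
    residue 1 _ (inj₁ refl) ()
    residue 1 _ (inj₂ refl) ()
    residue 2 _ (inj₁ refl) ()
    residue 2 _ (inj₂ refl) ()
    residue 3 _ (inj₁ refl) ()
    residue 3 _ (inj₂ refl) ()
    residue 4 _ (inj₁ refl) ()
    residue 4 _ (inj₂ refl) ()
    residue (suc (suc (suc (suc (suc _))))) (s≤s (s≤s (s≤s (s≤s (s≤s ())))))

2^[2n]≡4^n : ∀ n → 2 ^ (2 * n) ≡ 4 ^ n
2^[2n]≡4^n n = sym (^-*-assoc 2 2 n)

2^[2n+1]≡2*4^n : ∀ n → 2 ^ (2 * n + 1) ≡ 2 * 4 ^ n
2^[2n+1]≡2*4^n n = begin-equality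
  2 ^ (2 * n + 1)  ≡⟨ cong (2 ^_) (+-comm (2 * n) 1) ⟩
  2 * 2 ^ (2 * n)  ≡⟨ cong (2 *_) (2^[2n]≡4^n n) ⟩
  2 * 4 ^ n        ∎

2^[2n+2]≡[2^[n+1]]² : ∀ n → 2 ^ (2 * n + 2) ≡ 2 ^ (n + 1) * 2 ^ (n + 1)
2^[2n+2]≡[2^[n+1]]² n = begin-equality
  2 ^ (2 * n + 2)            ≡⟨ cong (2 ^_) exponent ⟩
  2 ^ ((n + 1) + (n + 1))    ≡⟨ ^-distribˡ-+-* 2 (n + 1) (n + 1) ⟩
  2 ^ (n + 1) * 2 ^ (n + 1)  ∎
  where
    exponent : 2 * n + 2 ≡ (n + 1) + (n + 1)
    exponent = solve (n ∷ [])

2*4^n-nonsquare : ∀ n a → a * a ≢ 2 * 4 ^ n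
2*4^n-nonsquare n a eq = m*m%3≢2 a (begin-equality
  a * a % 3              ≡⟨ cong (_% 3) eq ⟩
  2 * 4 ^ n % 3          ≡⟨ %-distribˡ-* 2 (4 ^ n) 3 ⟩
  2 * (4 ^ n % 3) % 3    ≡⟨ cong (λ r → 2 * r % 3) (m%d≡1⇒m^n%d≡1 4 n 3 refl) ⟩
  2                      ∎)

[4^[1+2m]+1]%5≡0 : ∀ m → (4 ^ suc (2 * m) + 1) % 5 ≡ 0
[4^[1+2m]+1]%5≡0 m = begin-equality
  (4 * 4 ^ (2 * m) + 1) % 5                ≡⟨ %-distribˡ-+ (4 * 4 ^ (2 * m)) 1 5 ⟩
  (4 * 4 ^ (2 * m) % 5 + 1) % 5            ≡⟨ cong (λ t → (t + 1) % 5) (%-distribˡ-* 4 (4 ^ (2 * m)) 5) ⟩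
  (4 * (4 ^ (2 * m) % 5) % 5 + 1) % 5      ≡⟨ cong (λ t → (4 * t % 5 + 1) % 5) 16^m%5≡1 ⟩
  0                                        ∎
  where
    16^m%5≡1 : 4 ^ (2 * m) % 5 ≡ 1
    16^m%5≡1 = trans (cong (_% 5) (sym (^-*-assoc 4 2 m))) (m%d≡1⇒m^n%d≡1 16 m 5 refl)

module FormDescent {c M : ℕ} (M<c : M < c) (M-nonsquare : ∀ a → a * a ≢ M) where

  -- Q a b = a² − c·a·b − b² takes the value M, resp. −M.
  Q≡M Q≡-M : ℕ → ℕ → Set
  Q≡M  a b = a * a ≡ c * a * b + b * b + M
  Q≡-M a b = a * a + M ≡ c * a * b + b * b

  M>0 : M > 0
  M>0 = n≢0⇒n>0 (λ M≡0 → M-nonsquare 0 (sym M≡0))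

  Q≡M-reflect : ∀ b s → Q≡M (c * b + s) b → Q≡-M b s
  Q≡M-reflect b s eq = sym (+-cancelˡ-≡ (c * b * (c * b) + c * b * s) _ _ (begin-equality
    c * b * (c * b) + c * b * s + (c * b * s + s * s)  ≡⟨ solve (c ∷ b ∷ s ∷ []) ⟩
    (c * b + s) * (c * b + s)                          ≡⟨ eq ⟩
    c * (c * b + s) * b + b * b + M                    ≡⟨ solve (c ∷ b ∷ s ∷ M ∷ []) ⟩
    c * b * (c * b) + c * b * s + (b * b + M)          ∎))

  Q≡-M-reflect : ∀ b u → Q≡-M (c * b + u) b → Q≡M b u
  Q≡-M-reflect b u eq = sym (+-cancelˡ-≡ (c * b * (c * b) + c * b * u) _ _ (begin-equality
    c * b * (c * b) + c * b * u + (c * b * u + u * u + M)  ≡⟨ solve (c ∷ b ∷ u ∷ M ∷ []) ⟩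
    (c * b + u) * (c * b + u) + M                          ≡⟨ eq ⟩
    c * (c * b + u) * b + b * b                            ≡⟨ solve (c ∷ b ∷ u ∷ []) ⟩
    c * b * (c * b) + c * b * u + b * b                    ∎))

  Q≡M⇒c*b≤a : ∀ {a b} → Q≡M a (suc b) → c * suc b ≤ a
  Q≡M⇒c*b≤a {a} {b} eq with c * suc b ≤? a
  ... | yes cb≤a = cb≤a
  ... | no  cb≰a = contradiction eq (<⇒≢ (begin-strict
    a * a                        ≤⟨ *-monoʳ-≤ a (<⇒≤ (≰⇒> cb≰a)) ⟩
    a * (c * suc b)              ≡⟨ *-assoc a c (suc b) ⟨
    a * c * suc b                ≡⟨ cong (_* suc b) (*-comm a c) ⟩
    c * a * suc b                <⟨ m<m+n _ z<s ⟩
    c * a * suc b + suc b * suc b  ≤⟨ m≤m+n _ M ⟩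
    c * a * suc b + suc b * suc b + M  ∎))

  Q≡-M⇒s<b : ∀ {b s} → Q≡-M (suc b) s → s < suc b
  Q≡-M⇒s<b {b} {s} eq with suc b ≤? s
  ... | no  b≰s = ≰⇒> b≰s
  ... | yes b≤s@(s≤s _) = contradiction eq (<⇒≢ (begin-strict
    suc b * suc b + M      ≡⟨ +-comm (suc b * suc b) M ⟩
    M + suc b * suc b      <⟨ +-mono-<-≤ (<-≤-trans M<c c≤cbs) (*-mono-≤ b≤s b≤s) ⟩
    c * suc b * s + s * s  ∎))
    where
      c≤cbs : c ≤ c * suc b * s
      c≤cbs = ≤-trans (m≤m*n c (suc b)) (m≤m*n (c * suc b) s)

  Q≡M⇒u<b : ∀ {b u} → Q≡M b u → u < b
  Q≡M⇒u<b {b} {u} eq with b ≤? u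
  ... | no  b≰u = ≰⇒> b≰u
  ... | yes b≤u = contradiction eq (<⇒≢ (begin-strict
    b * b                  ≤⟨ *-mono-≤ b≤u b≤u ⟩
    u * u                  <⟨ m<m+n (u * u) M>0 ⟩
    u * u + M              ≤⟨ m≤n+m (u * u + M) (c * b * u) ⟩
    c * b * u + (u * u + M)  ≡⟨ +-assoc (c * b * u) (u * u) M ⟨
    c * b * u + u * u + M  ∎))

  Q≡-M⇒c*b≤a : ∀ {a b} → Q≡-M a (suc b) → c * suc b ≤ a
  Q≡-M⇒c*b≤a {a} {b} eq with c * suc b ≤? a
  ... | yes cb≤a = cb≤a
  ... | no  cb≰a with m≤n⇒∃[o]m+o≡n (≰⇒> cb≰a)
  ... | d , 1+a+d≡cb = contradiction M≡ (M≢ a 1+a+d≡cb)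
    where
      M≡ : M ≡ a * suc d + suc b * suc b
      M≡ = +-cancelˡ-≡ (a * a) _ _ (begin-equality
        a * a + M                        ≡⟨ eq ⟩
        c * a * suc b + suc b * suc b    ≡⟨ cong (λ t → t * suc b + suc b * suc b) (*-comm c a) ⟩
        a * c * suc b + suc b * suc b    ≡⟨ cong (_+ suc b * suc b) (*-assoc a c (suc b)) ⟩
        a * (c * suc b) + suc b * suc b  ≡⟨ cong (λ t → a * t + suc b * suc b) 1+a+d≡cb ⟨
        a * (suc a + d) + suc b * suc b  ≡⟨ solve (a ∷ b ∷ d ∷ []) ⟩
        a * a + (a * suc d + suc b * suc b)  ∎)

      M≢ : ∀ a → suc a + d ≡ c * suc b → M ≢ a * suc d + suc b * suc b
      M≢ zero    _          M≡b²           = M-nonsquare (suc b) (sym M≡b²)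
      M≢ (suc a) 2+a+d≡cb M≡[1+a][1+d]+b² = <⇒≱ M<c (begin
        c                                  ≤⟨ m≤m*n c (suc b) ⟩
        c * suc b                          ≡⟨ 2+a+d≡cb ⟨
        suc (suc a) + d                    ≤⟨ m≤m+n _ (a * d + b * b + 2 * b) ⟩
        suc (suc a) + d + (a * d + b * b + 2 * b)  ≡⟨ solve (a ∷ b ∷ d ∷ []) ⟩
        suc a * suc d + suc b * suc b      ≡⟨ M≡[1+a][1+d]+b² ⟨
        M                                  ∎)

  Q≡M-descent : ∀ {a b} → Q≡M a (suc b) → ∃[ s ] s < suc b × Q≡-M (suc b) s
  Q≡M-descent {b = b} eq with m≤n⇒∃[o]m+o≡n (Q≡M⇒c*b≤a eq)
  ... | s , refl = s , Q≡-M⇒s<b reflected , reflected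
    where
      reflected : Q≡-M (suc b) s
      reflected = Q≡M-reflect (suc b) s eq

  Q≡-M-descent : ∀ {a b} → Q≡-M a (suc b) → ∃[ u ] u < suc b × Q≡M (suc b) u
  Q≡-M-descent {b = b} eq with m≤n⇒∃[o]m+o≡n (Q≡-M⇒c*b≤a eq)
  ... | u , refl = u , Q≡M⇒u<b reflected , reflected
    where
      reflected : Q≡M (suc b) u
      reflected = Q≡-M-reflect (suc b) u eq

  ¬Q≡M-at-0 : ∀ {a} → ¬ Q≡M a 0
  ¬Q≡M-at-0 {a} eq = M-nonsquare a (trans eq (cong (λ t → t + 0 + M) (*-zeroʳ (c * a))))

  ¬Q≡-M-at-0 : ∀ {a} → ¬ Q≡-M a 0
  ¬Q≡-M-at-0 {a} eq = <⇒≢ M>0 (sym (m+n≡0⇒n≡0 (a * a) (trans eq (cong (_+ 0) (*-zeroʳ (c * a))))))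

  ¬Q≡±M : ∀ b → (∀ {a} → ¬ Q≡M a b) × (∀ {a} → ¬ Q≡-M a b)
  ¬Q≡±M = <-rec _ λ where
    zero    _  → (λ {_} → ¬Q≡M-at-0) , (λ {_} → ¬Q≡-M-at-0)
    (suc b) ih → (λ {_} eq → let s , s<b , eq′ = Q≡M-descent eq  in proj₂ (ih s<b) eq′)
               , (λ {_} eq → let u , u<b , eq′ = Q≡-M-descent eq in proj₁ (ih u<b) eq′)

x²+M≢[n²+1]y² : ∀ {n M} → M < 2 * n → (∀ a → a * a ≢ M) →
                ∀ x y → x * x + M ≢ (n * n + 1) * (y * y)
x²+M≢[n²+1]y² {n} {M} M<2n M-nonsquare x y eq = proj₂ (¬Q≡±M y) (begin-equality
  (x + n * y) * (x + n * y) + M                    ≡⟨ solve (x ∷ n ∷ y ∷ M ∷ []) ⟩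
  x * x + M + n * y * (2 * x + n * y)              ≡⟨ cong (_+ n * y * (2 * x + n * y)) eq ⟩
  (n * n + 1) * (y * y) + n * y * (2 * x + n * y)  ≡⟨ solve (x ∷ n ∷ y ∷ []) ⟩
  2 * n * (x + n * y) * y + y * y                  ∎)
  where open FormDescent M<2n M-nonsquare

¬HasSolution-even : ∀ {k} l → 2 ∣ k → ¬ HasSolution k l
¬HasSolution-even {k} l (divides-refl m) (x , y , _ , _ , eq) = [m*m+2*4^n]%5≢0 x l (begin-equality
  (x * x + 2 * 4 ^ l) % 5              ≡⟨ cong (λ t → (x * x + t) % 5) (2^[2n+1]≡2*4^n l) ⟨
  (x * x + 2 ^ (2 * l + 1)) % 5        ≡⟨ cong (_% 5) eq ⟩
  (C * (y * y)) % 5                    ≡⟨ %-distribˡ-* C (y * y) 5 ⟩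
  C % 5 * (y * y % 5) % 5              ≡⟨ cong (λ r → r * (y * y % 5) % 5) C%5≡0 ⟩
  0                                    ∎)
  where
    C : ℕ
    C = 2 ^ (2 * k + 2) + 1

    exponent : 2 * k + 2 ≡ 2 * suc (2 * m)
    exponent = solve (m ∷ [])

    C%5≡0 : C % 5 ≡ 0
    C%5≡0 = trans (cong (λ e → (e + 1) % 5) (trans (cong (2 ^_) exponent) (2^[2n]≡4^n (suc (2 * m)))))
                  ([4^[1+2m]+1]%5≡0 m)

¬HasSolution-2l≤k : ∀ {k l} → 2 * l ≤ k → ¬ HasSolution k l
¬HasSolution-2l≤k {k} {l} 2l≤k (x , y , _ , _ , eq) =
  x²+M≢[n²+1]y² {n = 2 ^ (k + 1)} M<2n M-nonsquare x y
    (trans eq (cong (λ t → (t + 1) * (y * y)) (2^[2n+2]≡[2^[n+1]]² k)))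
  where
    M<2n : 2 ^ (2 * l + 1) < 2 * 2 ^ (k + 1)
    M<2n = ^-monoʳ-< 2 (s≤s (s≤s z≤n)) (s≤s (+-monoˡ-≤ 1 2l≤k))

    M-nonsquare : ∀ a → a * a ≢ 2 ^ (2 * l + 1)
    M-nonsquare a eq = 2*4^n-nonsquare l a (trans eq (2^[2n+1]≡2*4^n l))

HasSolution-2l≡k+1+2j : ∀ {k l} j → 2 * l ≡ k + 1 + 2 * j → HasSolution k l
HasSolution-2l≡k+1+2j {k} {l} j 2l≡k+1+2j with m≤n⇒∃[o]m+o≡n (^-monoʳ-≤ 2 (m≤n+m 1 k))
... | p , 2+p≡n = suc p * r , r , <-≤-trans (m^n>0 2 j) (m≤n*m r (suc p)) , m^n>0 2 j , (begin-equality
  suc p * r * (suc p * r) + 2 ^ (2 * l + 1)          ≡⟨ cong (suc p * r * (suc p * r) +_) M≡2nr² ⟩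
  suc p * r * (suc p * r) + 2 * n * (r * r)          ≡⟨ cong (λ t → suc p * r * (suc p * r) + 2 * t * (r * r)) 2+p≡n ⟨
  suc p * r * (suc p * r) + 2 * (2 + p) * (r * r)    ≡⟨ [n-1]²+2n≡n²+1 p r ⟩
  ((2 + p) * (2 + p) + 1) * (r * r)                  ≡⟨ cong (λ t → (t * t + 1) * (r * r)) 2+p≡n ⟩
  (n * n + 1) * (r * r)                              ≡⟨ cong (λ t → (t + 1) * (r * r)) (2^[2n+2]≡[2^[n+1]]² k) ⟨
  (2 ^ (2 * k + 2) + 1) * (r * r)                    ∎)
  where
    n r : ℕ
    n = 2 ^ (k + 1)
    r = 2 ^ j

    [n-1]²+2n≡n²+1 : ∀ p s → suc p * s * (suc p * s) + 2 * (2 + p) * (s * s) ≡ ((2 + p) * (2 + p) + 1) * (s * s)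
    [n-1]²+2n≡n²+1 = solve-∀

    exponent : k + 1 + 2 * j + 1 ≡ suc ((k + 1) + (j + j))
    exponent = solve (k ∷ j ∷ [])

    M≡2nr² : 2 ^ (2 * l + 1) ≡ 2 * n * (r * r)
    M≡2nr² = begin-equality
      2 ^ (2 * l + 1)              ≡⟨ cong (λ e → 2 ^ (e + 1)) 2l≡k+1+2j ⟩
      2 ^ (k + 1 + 2 * j + 1)      ≡⟨ cong (2 ^_) exponent ⟩
      2 * 2 ^ ((k + 1) + (j + j))  ≡⟨ cong (2 *_) (^-distribˡ-+-* 2 (k + 1) (j + j)) ⟩
      2 * (n * 2 ^ (j + j))        ≡⟨ cong (λ t → 2 * (n * t)) (^-distribˡ-+-* 2 j j) ⟩
      2 * (n * (r * r))            ≡⟨ *-assoc 2 n (r * r) ⟨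
      2 * n * (r * r)              ∎

HasSolution-odd : ∀ {k l} → k % 2 ≡ 1 → k < 2 * l → HasSolution k l
HasSolution-odd {k} {l} k%2≡1 k<2l with m≤n⇒∃[o]m+o≡n (m<n*o⇒m/o<n {n = l} (subst (k <_) (*-comm 2 l) k<2l))
... | j , 1+k/2+j≡l = HasSolution-2l≡k+1+2j {k} {l} j (begin-equality
  2 * l                          ≡⟨ cong (2 *_) 1+k/2+j≡l ⟨
  2 * (suc (k / 2) + j)          ≡⟨ rearrange (k / 2) j ⟩
  1 + k / 2 * 2 + 1 + 2 * j      ≡⟨ cong (λ t → t + 1 + 2 * j) k≡1+k/2*2 ⟨
  k + 1 + 2 * j                  ∎)
  where
    k≡1+k/2*2 : k ≡ 1 + k / 2 * 2
    k≡1+k/2*2 = trans (m≡m%n+[m/n]*n k 2) (cong (_+ k / 2 * 2) k%2≡1)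

    rearrange : ∀ m j → 2 * (suc m + j) ≡ 1 + m * 2 + 1 + 2 * j
    rearrange = solve-∀

proposition1 : (k l : ℕ) → l ≤ k →
    (k % 2 ≡ 0 → ¬ HasSolution k l) ×
    (k % 2 ≡ 1 → (k < 2 * l → HasSolution k l) × (2 * l ≤ k → ¬ HasSolution k l))
proposition1 k l _ =
  (λ k%2≡0 → ¬HasSolution-even l (m%n≡0⇒n∣m k 2 k%2≡0)) ,
  (λ k%2≡1 → HasSolution-odd {k} {l} k%2≡1 , ¬HasSolution-2l≤k {k} {l})
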